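{- Let $g_1, \ldots, g_n$ be positions in impartial games, each of which is a one-move game. Then $$\mathcal{G}(C_{(+, \mathrm{pass})}(g_1, \ldots, g_n)) = \mathcal{G}\big(C^{\mathrm{nim}}_{(+, \mathrm{pass})}(\mathcal{G}(g_1), \ldots, \mathcal{G}(g_n))\big).$$
   Context: All games are impartial two-player games under normal play: the player with no legal move loses. Every game is finite, i.e. each position has finitely many options and every play terminates. For a position $g$, $\mathrm{move}(g)$ denotes its set of options, i.e. the positions reachable in one move. A follower of $g$ is any position reachable from $g$ by a sequence of zero or more moves, so $g$ is a follower of itself. A terminal position is one with no options. The Sprague–Grundy value is defined recursively by $\mathcal{G}(g)=\mathrm{mex}\{\mathcal{G}(h): h\in\mathrm{move}(g)\}$, where $\mathrm{mex}(S)$ is the least nonnegative integer not in $S$. The disjunctive compound $C_+(g_1,\dots,g_n)$ has as options exactly the positions $C_+(g_1',\dots,g_n')$ such that, for some $i$, $g_i'\in\mathrm{move}(g_i)$ and $g_j'=g_j$ for all $j\neq i$. The one-pass compound $C_{(+,\mathrm{pass})}(g_1,\dots,g_n)$ is defined as follows. - If every $g_i$ is terminal, it has no options. - Otherwise, its options are all $C_{(+,\mathrm{pass})}(g_1',\dots,g_n')$ such that, for some $i$, $g_i'\in\mathrm{move}(g_i)$ and $g_j'=g_j$ for $j\ne i$, together with the single further option $C_+(g_1,\dots,g_n)$. This last option is the pass move. A position $g$ is a one-move game if, for every follower $g'$ of $g$, $\mathcal{G}(g')=0$ if and only if $g'$ is terminal. For nonnegative integers $m_1,\dots,m_n$, $C^{\mathrm{nim}}_{(+,\mathrm{pass})}(m_1,\dots,m_n)$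 denotes the one-pass compound whose $i$-th component is single-pile Nim with $m_i$ tokens. In single-pile Nim with $m$ tokens, the options are single piles with $m'$ tokens for each $0\le m'<m$. -}

module Defs where

open import Data.Nat using (ℕ; zero; suc; _+_; _≡ᵇ_)
open import Data.Bool using (Bool; true; false; not; _∧_; if_then_else_)
open import Data.List using (List; []; _∷_; _++_; map; length)
open import Data.Bool.ListAction using (any)
open import Data.List.Membership.Propositional using (_∈_)
open import Data.Vec as Vec using (Vec; []; _∷_)
open import Relation.Binary.PropositionalEquality using (_≡_)
open import Function.Bundles using (_⇔_)

-- A position is a finite, finitely branching rooted tree; its children
-- are its options.  (Every play terminates since trees are well-founded.)

data Game : Set where
  node : List Game → Game

move : Game → List Game
move (node gs) = gs

Terminal : Game → Set
Terminal g = move g ≡ []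

isTerminal : Game → Bool
isTerminal (node [])      = true
isTerminal (node (_ ∷ _)) = false

data Follower : Game → Game → Set where
  here : ∀ {g} → Follower g g
  step : ∀ {g g' h} → g' ∈ move g → Follower g' h → Follower g h

_∈ᵇ_ : ℕ → List ℕ → Bool
n ∈ᵇ xs = any (n ≡ᵇ_) xs

mexFrom : ℕ → ℕ → List ℕ → ℕ
mexFrom zero     start xs = start
mexFrom (suc f)  start xs = if start ∈ᵇ xs then mexFrom f (suc start) xs else start

-- mex xs = least nonnegative integer not in xs
-- (it is at most length xs, so length xs + 1 search steps suffice)
mex : List ℕ → ℕ
mex xs = mexFrom (suc (length xs)) 0 xs

mutual
  grundy : Game → ℕ
  grundy (node gs) = mex (grundyList gs)

  grundyList : List Game → List ℕ
  grundyList []       = []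
  grundyList (g ∷ gs) = grundy g ∷ grundyList gs

OneMove : Game → Set
OneMove g = ∀ g' → Follower g g' → (grundy g' ≡ 0) ⇔ Terminal g'

mutual
  nim : ℕ → Game
  nim m = node (nimOptions m)

  nimOptions : ℕ → List Game
  nimOptions zero    = []
  nimOptions (suc m) = nim m ∷ nimOptions m

componentMoves : ∀ {n} → Vec Game n → List (Vec Game n)
componentMoves []       = []
componentMoves (g ∷ gs) =
  map (λ g' → g' ∷ gs) (move g) ++ map (λ gs' → g ∷ gs') (componentMoves gs)

allTerminal : ∀ {n} → Vec Game n → Bool
allTerminal []       = true
allTerminal (g ∷ gs) = isTerminal g ∧ allTerminal gs

-- size of a game tree (number of nodes); a move strictly decreases the
-- total size of a tuple, so it bounds the length of every play.
mutual
  size : Game → ℕ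
  size (node gs) = suc (sizeList gs)

  sizeList : List Game → ℕ
  sizeList []       = 0
  sizeList (g ∷ gs) = size g + sizeList gs

sizeVec : ∀ {n} → Vec Game n → ℕ
sizeVec []       = 0
sizeVec (g ∷ gs) = size g + sizeVec gs

-- With the
-- budgets used below (≥ length of the longest play) the budget never
-- runs out, so these are exactly the compound game trees.
sumTree : ∀ {n} → ℕ → Vec Game n → Game
sumTree zero    gs = node []
sumTree (suc k) gs = node (map (sumTree k) (componentMoves gs))

C+ : ∀ {n} → Vec Game n → Game
C+ gs = sumTree (sizeVec gs) gs

passTree : ∀ {n} → ℕ → Vec Game n → Game
passTree zero    gs = node []
passTree (suc k) gs =
  if allTerminal gs
  then node []
  else node (map (passTree k) (componentMoves gs) ++ (C+ gs ∷ []))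

C+pass : ∀ {n} → Vec Game n → Game
C+pass gs = passTree (suc (sizeVec gs)) gs

C+passNim : ∀ {n} → Vec ℕ n → Game
C+passNim ms = C+pass (Vec.map nim ms)

-- Write v for the vector of values 𝒢(gᵢ) and compare a compound T(g₁,…,gₙ) with
-- T(nim v₁,…,nim vₙ) by the mex rule, inducting on the total size.  A move in
-- component i leads to a position whose value, by induction, is that of the nim
-- compound with vᵢ replaced by 𝒢(gᵢ').  Every value below vᵢ is such a 𝒢(gᵢ'),
-- so the real game can imitate each nim move; and 𝒢(gᵢ') ≠ vᵢ, while the value
-- of the nim compound is injective in each coordinate (a smaller pile is an
-- option of a larger one), so no component move of the real game reaches the
-- value of the nim compound.  This settles C₊.  For the one-pass compound the
-- pass moves lead to C₊ on both sides, which have equal values by the first case,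
-- and the one-move hypothesis says that gᵢ is terminal exactly when nim 𝒢(gᵢ) is,
-- so the pass move is available on both sides at once.
module Submission where

open import Defs
open import Data.Nat using (ℕ)
open import Data.Fin using (Fin)
open import Data.Vec using (Vec; lookup; map)
open import Relation.Binary.PropositionalEquality using (_≡_)

open import Data.Bool using (T; true; false; if_then_else_)
open import Data.Bool.Properties using (T-≡)
open import Data.Empty using (⊥-elim)
open import Data.Fin as Fin using (_≟_)
open import Data.Fin.Properties using (toℕ<n; pigeonhole)
open import Data.List as List using (List; []; _∷_; _++_; length)
open import Data.List.Properties using (map-cong-local; ++-identityʳ)
open import Data.List.Membership.Propositional using (_∈_; _∉_)
open import Data.List.Membership.Propositional.Properties
  using (∈-map⁺; ∈-map⁻; ∈-++⁺ˡ; ∈-++⁺ʳ; ∈-++⁻)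
open import Data.List.Membership.Setoid.Properties using (index-injective)
open import Data.List.Relation.Unary.All as All using ()
open import Data.List.Relation.Unary.Any as Any using (here; there)
open import Data.List.Relation.Unary.Any.Properties using (any⁺; any⁻)
open import Data.Nat using (suc; _+_; _<_; _≤_; _≤?_; s≤s)
open import Data.Nat.Induction using (<-wellFounded)
open import Data.Nat.Properties
  using (≤-refl; ≤-trans; ≤-pred; <-asym; <-cmp; <⇒≢; ≰⇒>; m≤n⇒m<n∨m≡n;
         +-identityʳ; +-suc; m≤m+n; m≤n+m; +-monoˡ-<; +-monoʳ-<; ≡ᵇ⇒≡; ≡⇒≡ᵇ)
open import Data.Product using (∃; ∃₂; _×_; _,_)
open import Data.Sum using (_⊎_; inj₁; inj₂)
open import Data.Unit using (⊤; tt)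
open import Data.Vec using ([]; _∷_; _[_]≔_)
open import Data.Vec.Properties
  using (lookup-map; map-[]≔; []≔-idempotent; []≔-lookup; lookup∘update; lookup∘update′)
open import Function.Bundles using (Equivalence)
open import Induction.WellFounded using (Acc; acc)
open import Relation.Binary using (tri<; tri≈; tri>)
open import Relation.Binary.PropositionalEquality
  using (_≢_; refl; sym; trans; cong; subst; setoid; module ≡-Reasoning)
open import Relation.Nullary using (yes; no; contradiction)

∈ᵇ⇒∈ : ∀ {n} xs → T (n ∈ᵇ xs) → n ∈ xs
∈ᵇ⇒∈ {n} xs t = Any.map (λ {x} → ≡ᵇ⇒≡ n x) (any⁻ _ xs t)

∈⇒∈ᵇ : ∀ {n xs} → n ∈ xs → T (n ∈ᵇ xs)
∈⇒∈ᵇ {n} n∈xs = any⁺ _ (Any.map (λ {x} → ≡⇒≡ᵇ n x) n∈xs)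

AllBelow : ℕ → List ℕ → Set
AllBelow k xs = ∀ {j} → j < k → j ∈ xs

allBelow-suc : ∀ {k xs} → AllBelow k xs → k ∈ xs → AllBelow (suc k) xs
allBelow-suc below k∈xs j<1+k with m≤n⇒m<n∨m≡n (≤-pred j<1+k)
... | inj₁ j<k  = below j<k
... | inj₂ refl = k∈xs

-- Positions in xs of 0, 1, …, k - 1 are distinct, so the pigeonhole principle applies.
allBelow⇒≤length : ∀ {k xs} → AllBelow k xs → k ≤ length xs
allBelow⇒≤length {k} {xs} below with k ≤? length xs
... | yes k≤len = k≤len
... | no  k≰len = collision (pigeonhole (≰⇒> k≰len) position)
  where
  position : Fin k → Fin (length xs)
  position i = Any.index (below (toℕ<n i))

  collision : (∃₂ λ i j → i Fin.< j × position i ≡ position j) → k ≤ length xs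
  collision (i , j , i<j , same) =
    contradiction (index-injective (setoid ℕ) (below (toℕ<n i)) (below (toℕ<n j)) same) (<⇒≢ i<j)

mexFrom-allBelow : ∀ fuel {start} xs → AllBelow start xs → AllBelow (mexFrom fuel start xs) xs
mexFrom-allBelow 0          xs below = below
mexFrom-allBelow (suc fuel) {start} xs below with start ∈ᵇ xs in found
... | true  = mexFrom-allBelow fuel xs (allBelow-suc below (∈ᵇ⇒∈ xs (Equivalence.from T-≡ found)))
... | false = below

-- Running out of fuel would put more than length xs distinct numbers into xs.
mexFrom-∉ : ∀ fuel {start} xs → AllBelow start xs → length xs < start + fuel →
            mexFrom fuel start xs ∉ xs
mexFrom-∉ 0 {start} xs below len start∈xs =
  <-asym (subst (length xs <_) (+-identityʳ start) len)
         (allBelow⇒≤length (allBelow-suc below start∈xs))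
mexFrom-∉ (suc fuel) {start} xs below len with start ∈ᵇ xs in found
... | true  = mexFrom-∉ fuel xs (allBelow-suc below (∈ᵇ⇒∈ xs (Equivalence.from T-≡ found)))
                        (subst (length xs <_) (+-suc start fuel) len)
... | false = λ start∈xs → subst T found (∈⇒∈ᵇ start∈xs)

mex-allBelow : ∀ xs → AllBelow (mex xs) xs
mex-allBelow xs = mexFrom-allBelow (suc (length xs)) xs (λ ())

mex-∉ : ∀ xs → mex xs ∉ xs
mex-∉ xs = mexFrom-∉ (suc (length xs)) xs (λ ()) ≤-refl

grundyList≡map : ∀ gs → grundyList gs ≡ List.map grundy gs
grundyList≡map []       = refl
grundyList≡map (g ∷ gs) = cong (grundy g ∷_) (grundyList≡map gs)

grundy-unfold : ∀ g → grundy g ≡ mex (List.map grundy (move g))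
grundy-unfold (node gs) = cong mex (grundyList≡map gs)

grundy-below : ∀ g {j} → j < grundy g → ∃ λ h → h ∈ move g × grundy h ≡ j
grundy-below g {j} j<g
  with h , h∈g , j≡h ← ∈-map⁻ grundy (mex-allBelow _ (subst (j <_) (grundy-unfold g) j<g)) =
  h , h∈g , sym j≡h

grundy-option≢ : ∀ g {h} → h ∈ move g → grundy h ≢ grundy g
grundy-option≢ g h∈g h≡g =
  mex-∉ _ (subst (_∈ _) (trans h≡g (grundy-unfold g)) (∈-map⁺ grundy h∈g))

grundy-≡-byOptions : ∀ g h →
  (∀ {h'} → h' ∈ move h → ∃ λ g' → g' ∈ move g × grundy g' ≡ grundy h') →
  (∀ {g'} → g' ∈ move g → grundy g' ≢ grundy h) →
  grundy g ≡ grundy h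
grundy-≡-byOptions g h imitate avoid with <-cmp (grundy g) (grundy h)
... | tri≈ _ g≡h _ = g≡h
... | tri> _ _ h<g with g' , g'∈g , g'≡h ← grundy-below g h<g = ⊥-elim (avoid g'∈g g'≡h)
... | tri< g<h _ _
  with h' , h'∈h , h'≡g ← grundy-below h g<h
  with g' , g'∈g , g'≡h' ← imitate h'∈h = ⊥-elim (grundy-option≢ g g'∈g (trans g'≡h' h'≡g))

sameGrundy : ∀ {xs ys : List Game} {y} → List.map grundy xs ≡ List.map grundy ys → y ∈ ys →
             ∃ λ x → x ∈ xs × grundy x ≡ grundy y
sameGrundy {xs} values y∈ys
  with x , x∈xs , y≡x ← ∈-map⁻ grundy (subst (_ ∈_) (sym values) (∈-map⁺ grundy y∈ys)) =
  x , x∈xs , sym y≡x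

nim-option⁺ : ∀ {m m'} → m' < m → nim m' ∈ move (nim m)
nim-option⁺ {suc m} m'<1+m with m≤n⇒m<n∨m≡n (≤-pred m'<1+m)
... | inj₁ m'<m = there (nim-option⁺ m'<m)
... | inj₂ refl = here refl

nim-option⁻ : ∀ {m h} → h ∈ move (nim m) → ∃ λ m' → m' < m × h ≡ nim m'
nim-option⁻ {suc m} (here h≡nim) = m , ≤-refl , h≡nim
nim-option⁻ {suc m} (there h∈nim) with m' , m'<m , h≡nim ← nim-option⁻ h∈nim =
  m' , ≤-trans m'<m (m≤n+m m 1) , h≡nim

∈-componentMoves⁺ : ∀ {n} (gs : Vec Game n) i {g'} → g' ∈ move (lookup gs i) →
                    gs [ i ]≔ g' ∈ componentMoves gs
∈-componentMoves⁺ (g ∷ gs) Fin.zero    g'∈g = ∈-++⁺ˡ (∈-map⁺ (_∷ gs) g'∈g)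
∈-componentMoves⁺ (g ∷ gs) (Fin.suc i) g'∈g =
  ∈-++⁺ʳ (List.map (_∷ gs) (move g)) (∈-map⁺ (g ∷_) (∈-componentMoves⁺ gs i g'∈g))

∈-componentMoves⁻ : ∀ {n} (gs : Vec Game n) {hs} → hs ∈ componentMoves gs →
                    ∃₂ λ i g' → g' ∈ move (lookup gs i) × hs ≡ gs [ i ]≔ g'
∈-componentMoves⁻ (g ∷ gs) hs∈ with ∈-++⁻ (List.map (_∷ gs) (move g)) hs∈
... | inj₁ here∈ with g' , g'∈g , refl ← ∈-map⁻ (_∷ gs) here∈ = Fin.zero , g' , g'∈g , refl
... | inj₂ later∈
  with hs' , hs'∈ , refl ← ∈-map⁻ (g ∷_) later∈
  with i , g' , g'∈ , refl ← ∈-componentMoves⁻ gs hs'∈ = Fin.suc i , g' , g'∈ , refl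

componentMoves-allTerminal : ∀ {n} (gs : Vec Game n) → allTerminal gs ≡ true → componentMoves gs ≡ []
componentMoves-allTerminal []                  _    = refl
componentMoves-allTerminal (node [] ∷ gs)      term =
  cong (List.map (node [] ∷_)) (componentMoves-allTerminal gs term)
componentMoves-allTerminal (node (_ ∷ _) ∷ gs) ()

size≤sizeList : ∀ {g gs} → g ∈ gs → size g ≤ sizeList gs
size≤sizeList {gs = h ∷ hs} (here refl) = m≤m+n (size h) (sizeList hs)
size≤sizeList {gs = h ∷ hs} (there g∈) = ≤-trans (size≤sizeList g∈) (m≤n+m (sizeList hs) (size h))

size-option : ∀ {g g'} → g' ∈ move g → size g' < size g
size-option {node gs} g'∈ = s≤s (size≤sizeList g'∈)

sizeVec-update : ∀ {n} (gs : Vec Game n) i {g'} → g' ∈ move (lookup gs i) →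
                 sizeVec (gs [ i ]≔ g') < sizeVec gs
sizeVec-update (g ∷ gs) Fin.zero    g'∈ = +-monoˡ-< (sizeVec gs) (size-option g'∈)
sizeVec-update (g ∷ gs) (Fin.suc i) g'∈ = +-monoʳ-< (size g) (sizeVec-update gs i g'∈)

sizeVec-componentMoves : ∀ {n} (gs : Vec Game n) {hs} → hs ∈ componentMoves gs → sizeVec hs < sizeVec gs
sizeVec-componentMoves gs hs∈ with i , g' , g'∈ , refl ← ∈-componentMoves⁻ gs hs∈ =
  sizeVec-update gs i g'∈

sumTree-budget : ∀ {n} k k' (gs : Vec Game n) → sizeVec gs ≤ k → sizeVec gs ≤ k' →
                 sumTree k gs ≡ sumTree k' gs
sumTree-budget (suc k) (suc k') gs@(node _ ∷ _) (s≤s ≤k) (s≤s ≤k') =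
  cong node (map-cong-local (All.tabulate λ hs∈ →
    let smaller = sizeVec-componentMoves gs hs∈ in
    sumTree-budget k k' _ (≤-pred (≤-trans smaller (s≤s ≤k))) (≤-pred (≤-trans smaller (s≤s ≤k')))))
sumTree-budget 0       0        [] _ _ = refl
sumTree-budget 0       (suc _)  [] _ _ = refl
sumTree-budget (suc _) 0        [] _ _ = refl
sumTree-budget (suc _) (suc _)  [] _ _ = refl
sumTree-budget 0 _ (node _ ∷ _) () _
sumTree-budget _ 0 (node _ ∷ _) _ ()

move-C+ : ∀ {n} (gs : Vec Game n) → move (C+ gs) ≡ List.map C+ (componentMoves gs)
move-C+ []                = refl
move-C+ gs@(node _ ∷ _) = map-cong-local (All.tabulate λ hs∈ →
  sumTree-budget _ _ _ (≤-pred (sizeVec-componentMoves gs hs∈)) ≤-refl)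

passTree-budget : ∀ {n} k k' (gs : Vec Game n) → sizeVec gs < k → sizeVec gs < k' →
                  passTree k gs ≡ passTree k' gs
passTree-budget (suc k) (suc k') gs (s≤s ≤k) (s≤s ≤k') with allTerminal gs
... | true  = refl
... | false = cong (λ options → node (options ++ C+ gs ∷ [])) (map-cong-local (All.tabulate λ hs∈ →
  let smaller = sizeVec-componentMoves gs hs∈ in
  passTree-budget k k' _ (≤-trans smaller ≤k) (≤-trans smaller ≤k')))

passOption : ∀ {n} → Vec Game n → List Game
passOption gs = if allTerminal gs then [] else C+ gs ∷ []

move-C+pass : ∀ {n} (gs : Vec Game n) →
              move (C+pass gs) ≡ List.map C+pass (componentMoves gs) ++ passOption gs
move-C+pass gs with allTerminal gs in term
... | true  = cong (λ hss → List.map C+pass hss ++ []) (sym (componentMoves-allTerminal gs term))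
... | false = cong (_++ C+ gs ∷ []) (map-cong-local (All.tabulate λ hs∈ →
  passTree-budget _ _ _ (sizeVec-componentMoves gs hs∈) ≤-refl))

module Transfer {n} (T : Vec Game n → Game) (extra : Vec Game n → List Game)
  (move-T : ∀ gs → move (T gs) ≡ List.map T (componentMoves gs) ++ extra gs)
  (P : Vec Game n → Set)
  (P-update : ∀ gs i {g'} → P gs → g' ∈ move (lookup gs i) → P (gs [ i ]≔ g'))
  (extra-grundy : ∀ gs → P gs → List.map grundy (extra gs) ≡ List.map grundy (extra (map nim (map grundy gs))))
  where

  nimValue : Vec ℕ n → ℕ
  nimValue v = grundy (T (map nim v))

  T-option⁺ : ∀ gs i {g'} → g' ∈ move (lookup gs i) → T (gs [ i ]≔ g') ∈ move (T gs)
  T-option⁺ gs i g'∈ =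
    subst (_ ∈_) (sym (move-T gs)) (∈-++⁺ˡ (∈-map⁺ T (∈-componentMoves⁺ gs i g'∈)))

  extra-option : ∀ gs {x} → x ∈ extra gs → x ∈ move (T gs)
  extra-option gs x∈ = subst (_ ∈_) (sym (move-T gs)) (∈-++⁺ʳ _ x∈)

  T-option⁻ : ∀ gs {x} → x ∈ move (T gs) →
              (∃₂ λ i g' → g' ∈ move (lookup gs i) × x ≡ T (gs [ i ]≔ g')) ⊎ x ∈ extra gs
  T-option⁻ gs x∈ with ∈-++⁻ (List.map T (componentMoves gs)) (subst (_ ∈_) (move-T gs) x∈)
  ... | inj₂ x∈extra = inj₂ x∈extra
  ... | inj₁ x∈component
    with hs , hs∈ , refl ← ∈-map⁻ T x∈component
    with i , g' , g'∈ , refl ← ∈-componentMoves⁻ gs hs∈ = inj₁ (i , g' , g'∈ , refl)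

  nimT-option⁻ : ∀ v {y} → y ∈ move (T (map nim v)) →
                 (∃₂ λ i m' → m' < lookup v i × y ≡ T (map nim (v [ i ]≔ m'))) ⊎ y ∈ extra (map nim v)
  nimT-option⁻ v y∈ with T-option⁻ (map nim v) y∈
  ... | inj₂ y∈extra = inj₂ y∈extra
  ... | inj₁ (i , h , h∈ , refl)
    with m' , m'<v , refl ← nim-option⁻ (subst (λ g → h ∈ move g) (lookup-map i nim v) h∈) =
    inj₁ (i , m' , m'<v , cong T (sym (map-[]≔ nim v i)))

  nimValue-decreasing : ∀ v i {a b} → a < b → nimValue (v [ i ]≔ a) ≢ nimValue (v [ i ]≔ b)
  nimValue-decreasing v i {a} {b} a<b =
    grundy-option≢ (T nims-b) (subst (λ gs → T gs ∈ move (T nims-b)) nims-a smaller)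
    where
    nims-b : Vec Game n
    nims-b = map nim (v [ i ]≔ b)
    nims-a : nims-b [ i ]≔ nim a ≡ map nim (v [ i ]≔ a)
    nims-a = begin
      nims-b [ i ]≔ nim a                   ≡⟨ cong (_[ i ]≔ nim a) (map-[]≔ nim v i) ⟩
      (map nim v [ i ]≔ nim b) [ i ]≔ nim a ≡⟨ []≔-idempotent (map nim v) i ⟩
      map nim v [ i ]≔ nim a                ≡⟨ map-[]≔ nim v i ⟨
      map nim (v [ i ]≔ a)                  ∎
      where open ≡-Reasoning
    lookup-b : lookup nims-b i ≡ nim b
    lookup-b = trans (lookup-map i nim (v [ i ]≔ b)) (cong nim (lookup∘update i v b))
    smaller : T (nims-b [ i ]≔ nim a) ∈ move (T nims-b)
    smaller = T-option⁺ nims-b i (subst (λ g → nim a ∈ move g) (sym lookup-b) (nim-option⁺ a<b))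

  nimValue-injectiveAt : ∀ v i {a} → a ≢ lookup v i → nimValue (v [ i ]≔ a) ≢ nimValue v
  nimValue-injectiveAt v i {a} a≢vᵢ with <-cmp a (lookup v i)
  ... | tri≈ _ a≡vᵢ _ = ⊥-elim (a≢vᵢ a≡vᵢ)
  ... | tri< a<vᵢ _ _ = λ same →
    nimValue-decreasing v i a<vᵢ (trans same (sym (cong nimValue ([]≔-lookup v i))))
  ... | tri> _ _ vᵢ<a = λ same →
    nimValue-decreasing v i vᵢ<a (trans (cong nimValue ([]≔-lookup v i)) (sym same))

  grundy-T : ∀ gs → P gs → grundy (T gs) ≡ nimValue (map grundy gs)
  grundy-T gs = go gs (<-wellFounded (sizeVec gs))
    where
    go : ∀ gs → Acc _<_ (sizeVec gs) → P gs → grundy (T gs) ≡ nimValue (map grundy gs)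
    go gs (acc smaller) p = grundy-≡-byOptions (T gs) (T (map nim v)) imitate avoid
      where
      v = map grundy gs

      lookup-v : ∀ i → lookup v i ≡ grundy (lookup gs i)
      lookup-v i = lookup-map i grundy gs

      IH : ∀ i {g'} → g' ∈ move (lookup gs i) → grundy (T (gs [ i ]≔ g')) ≡ nimValue (v [ i ]≔ grundy g')
      IH i g'∈ = trans (go _ (smaller (sizeVec-update gs i g'∈)) (P-update gs i p g'∈))
                       (cong nimValue (map-[]≔ grundy gs i))

      imitate : ∀ {y} → y ∈ move (T (map nim v)) → ∃ λ x → x ∈ move (T gs) × grundy x ≡ grundy y
      imitate y∈ with nimT-option⁻ v y∈
      ... | inj₂ y∈extra with x , x∈ , same ← sameGrundy (extra-grundy gs p) y∈extra =
        x , extra-option gs x∈ , same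
      ... | inj₁ (i , m' , m'<vᵢ , refl)
        with g' , g'∈ , refl ← grundy-below (lookup gs i) (subst (m' <_) (lookup-v i) m'<vᵢ) =
        T (gs [ i ]≔ g') , T-option⁺ gs i g'∈ , IH i g'∈

      avoid : ∀ {x} → x ∈ move (T gs) → grundy x ≢ nimValue v
      avoid x∈ with T-option⁻ gs x∈
      ... | inj₁ (i , g' , g'∈ , refl) = λ same →
        nimValue-injectiveAt v i (λ g'≡vᵢ → grundy-option≢ (lookup gs i) g'∈ (trans g'≡vᵢ (lookup-v i)))
          (trans (sym (IH i g'∈)) same)
      ... | inj₂ x∈extra with y , y∈ , same ← sameGrundy (sym (extra-grundy gs p)) x∈extra = λ x≡ →
        grundy-option≢ (T (map nim v)) (extra-option (map nim v) y∈) (trans same x≡)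

grundy-C+ : ∀ {n} (gs : Vec Game n) → grundy (C+ gs) ≡ grundy (C+ (map nim (map grundy gs)))
grundy-C+ gs = Transfer.grundy-T C+ (λ _ → []) move-C+[] (λ _ → ⊤) (λ _ _ _ _ → tt) (λ _ _ → refl) gs tt
  where
  move-C+[] : ∀ gs → move (C+ gs) ≡ List.map C+ (componentMoves gs) ++ []
  move-C+[] gs = trans (move-C+ gs) (sym (++-identityʳ _))

AllOneMove : ∀ {n} → Vec Game n → Set
AllOneMove gs = ∀ i → OneMove (lookup gs i)

oneMove-option : ∀ {g g'} → OneMove g → g' ∈ move g → OneMove g'
oneMove-option one g'∈ h follower = one h (step g'∈ follower)

allOneMove-update : ∀ {n} (gs : Vec Game n) i {g'} → AllOneMove gs → g' ∈ move (lookup gs i) →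
                    AllOneMove (gs [ i ]≔ g')
allOneMove-update gs i ones g'∈ j with j ≟ i
... | yes refl = subst OneMove (sym (lookup∘update i gs _)) (oneMove-option (ones i) g'∈)
... | no  j≢i  = subst OneMove (sym (lookup∘update′ j≢i gs _)) (ones j)

isTerminal-nim-grundy : ∀ g → OneMove g → isTerminal (nim (grundy g)) ≡ isTerminal g
isTerminal-nim-grundy (node [])       _   = refl
isTerminal-nim-grundy (node (h ∷ hs)) one with grundy (node (h ∷ hs)) in value
... | suc _ = refl
... | 0 with () ← Equivalence.to (one _ here) value

allTerminal-nim-grundy : ∀ {n} (gs : Vec Game n) → AllOneMove gs →
                         allTerminal (map nim (map grundy gs)) ≡ allTerminal gs
allTerminal-nim-grundy []       _    = refl
allTerminal-nim-grundy (g ∷ gs) ones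
  rewrite isTerminal-nim-grundy g (ones Fin.zero)
        | allTerminal-nim-grundy gs (λ i → ones (Fin.suc i)) = refl

passOption-grundy : ∀ {n} (gs : Vec Game n) → AllOneMove gs →
  List.map grundy (passOption gs) ≡ List.map grundy (passOption (map nim (map grundy gs)))
passOption-grundy gs ones rewrite allTerminal-nim-grundy gs ones with allTerminal gs
... | true  = refl
... | false = cong (_∷ []) (grundy-C+ gs)

theorem5 : (n : ℕ) (gs : Vec Game n) → (∀ (i : Fin n) → OneMove (lookup gs i)) →
    grundy (C+pass gs) ≡ grundy (C+passNim (map grundy gs))
theorem5 n gs ones =
  Transfer.grundy-T C+pass passOption move-C+pass AllOneMove allOneMove-update passOption-grundy gs ones
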